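{- Let $G=(V,E)$ be a finite simple graph and let $k\geq 0$ be an integer. If $G$ can be contracted to a planar graph by using at most $k$ edge contractions, then there exists a set $S\subseteq V$ with $|S|\leq k$ such that $G-S$ is planar.
   Context: All graphs are finite, undirected, without loops or multiple edges. The contraction of an edge $uv$ removes $u$ and $v$ and replaces them by a new vertex adjacent to precisely those vertices that were adjacent to $u$ or $v$. $G-S$ denotes the subgraph of $G$ induced by $V\setminus S$. -}

module Defs where

open import Data.Bool using (Bool; true; false; not; T; if_then_else_)
open import Data.Nat using (ℕ; zero; suc)
open import Data.Fin using (Fin; inject₁; toℕ) renaming (suc to fsuc)
open import Data.List using (List; []; _∷_)
open import Data.Product using (Σ; ∃; _×_; _,_; proj₁; proj₂)
open import Data.Sum using (_⊎_; inj₁; inj₂)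
open import Data.Unit using (⊤; tt)
open import Data.Empty using (⊥)
open import Data.Rational using (ℚ; _-_; _*_; _≤_; _⊓_; _⊔_; 0ℚ)
open import Function.Bundles using (_↔_)
open import Relation.Nullary using (¬_; Dec; yes; no)
open import Relation.Nullary.Decidable using (⌊_⌋)
open import Relation.Binary.Definitions using (DecidableEquality)
open import Relation.Binary.PropositionalEquality using (_≡_; _≢_; refl)
open import Data.Bool.Properties using (T-irrelevant)
import Data.Fin

record Graph : Set₁ where
  field
    V      : Set
    _≟_    : DecidableEquality V
    E      : V → V → Set
    E-sym  : ∀ {x y} → E x y → E y x
    E-irr  : ∀ {x} → ¬ E x x
open Graph public

Finite : Graph → Set
Finite G = Σ ℕ λ n → V G ↔ Fin n

-- Edge contraction of uv: u and v are removed and replaced by a new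
-- vertex (inj₂ tt) adjacent to exactly the vertices adjacent to u or v.

module _ (G : Graph) where
  -- "x differs from a" as a proof-irrelevant boolean test
  _≠ᵇ_ : V G → V G → Set
  x ≠ᵇ a = T (not ⌊ _≟_ G x a ⌋)

  CV : V G → V G → Set
  CV u v = Σ (V G) (λ x → (x ≠ᵇ u) × (x ≠ᵇ v)) ⊎ ⊤

  CE : (u v : V G) → CV u v → CV u v → Set
  CE u v (inj₁ (a , _)) (inj₁ (b , _)) = E G a b
  CE u v (inj₁ (a , _)) (inj₂ _)       = E G a u ⊎ E G a v
  CE u v (inj₂ _)       (inj₁ (b , _)) = E G u b ⊎ E G v b
  CE u v (inj₂ _)       (inj₂ _)       = ⊥

  CE-sym : (u v : V G) → ∀ {x y} → CE u v x y → CE u v y x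
  CE-sym u v {inj₁ _} {inj₁ _} e = E-sym G e
  CE-sym u v {inj₁ _} {inj₂ _} (inj₁ e) = inj₁ (E-sym G e)
  CE-sym u v {inj₁ _} {inj₂ _} (inj₂ e) = inj₂ (E-sym G e)
  CE-sym u v {inj₂ _} {inj₁ _} (inj₁ e) = inj₁ (E-sym G e)
  CE-sym u v {inj₂ _} {inj₁ _} (inj₂ e) = inj₂ (E-sym G e)
  CE-sym u v {inj₂ _} {inj₂ _} ()

  CE-irr : (u v : V G) → ∀ {x} → ¬ CE u v x x
  CE-irr u v {inj₁ _} e = E-irr G e
  CE-irr u v {inj₂ _} ()

  CV-dec : (u v : V G) → DecidableEquality (CV u v)
  CV-dec u v (inj₁ (a , p₁ , p₂)) (inj₁ (b , q₁ , q₂)) with _≟_ G a b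
  ... | no a≢b = no λ { refl → a≢b refl }
  ... | yes refl with T-irrelevant p₁ q₁ | T-irrelevant p₂ q₂
  ... | refl | refl = yes refl
  CV-dec u v (inj₁ _) (inj₂ _) = no λ ()
  CV-dec u v (inj₂ _) (inj₁ _) = no λ ()
  CV-dec u v (inj₂ tt) (inj₂ tt) = yes refl

contract : (G : Graph) (u v : V G) → Graph
contract G u v = record
  { V = CV G u v ; _≟_ = CV-dec G u v ; E = CE G u v
  ; E-sym = λ {x} {y} → CE-sym G u v {x} {y} ; E-irr = λ {x} → CE-irr G u v {x} }

data _⟶⟨_⟩_ : Graph → ℕ → Graph → Set₁ where
  done : ∀ {G k} → G ⟶⟨ k ⟩ G
  step : ∀ {G k H} (u v : V G) → E G u v →
         contract G u v ⟶⟨ k ⟩ H → G ⟶⟨ suc k ⟩ H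

memᵇ : {A : Set} → DecidableEquality A → A → List A → Bool
memᵇ eq x [] = false
memᵇ eq x (y ∷ ys) = if ⌊ eq x y ⌋ then true else memᵇ eq x ys

_─_ : (G : Graph) → List (V G) → Graph
G ─ S = record
  { V = Σ (V G) (λ x → T (not (memᵇ (_≟_ G) x S)))
  ; _≟_ = dec
  ; E = λ x y → E G (proj₁ x) (proj₁ y)
  ; E-sym = E-sym G
  ; E-irr = E-irr G }
  where
  dec : DecidableEquality (Σ (V G) (λ x → T (not (memᵇ (_≟_ G) x S))))
  dec (a , p) (b , q) with _≟_ G a b
  ... | no a≢b = no λ { refl → a≢b refl }
  ... | yes refl with T-irrelevant p q
  ... | refl = yes refl

-- Planarity (Diestel-style: vertices are distinct points, edges are
-- polygonal arcs meeting only at common endpoints), with points in ℚ².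

Point : Set
Point = ℚ × ℚ

cross : Point → Point → Point → ℚ
cross (ax , ay) (bx , by) (cx , cy) = ((bx - ax) * (cy - ay)) - ((by - ay) * (cx - ax))

OnSeg : Point → Point → Point → Set
OnSeg a b q =
  cross a b q ≡ 0ℚ
  × ((proj₁ a ⊓ proj₁ b) ≤ proj₁ q) × (proj₁ q ≤ (proj₁ a ⊔ proj₁ b))
  × ((proj₂ a ⊓ proj₂ b) ≤ proj₂ q) × (proj₂ q ≤ (proj₂ a ⊔ proj₂ b))

record Polyline : Set where
  field
    m   : ℕ
    pts : Fin (suc (suc m)) → Point
open Polyline public

start end : Polyline → Point
start P = pts P Data.Fin.zero
end P = pts P (Data.Fin.fromℕ (suc (m P)))

OnSegᵢ : (P : Polyline) → Fin (suc (m P)) → Point → Set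
OnSegᵢ P i = OnSeg (pts P (inject₁ i)) (pts P (fsuc i))

OnArc : Polyline → Point → Set
OnArc P q = ∃ λ i → OnSegᵢ P i q

IsArc : Polyline → Set
IsArc P =
  (∀ i → pts P (inject₁ i) ≢ pts P (fsuc i))
  × (∀ i j q → OnSegᵢ P i q → OnSegᵢ P j q →
       (i ≡ j)
       ⊎ (toℕ j ≡ suc (toℕ i) × q ≡ pts P (fsuc i))
       ⊎ (toℕ i ≡ suc (toℕ j) × q ≡ pts P (fsuc j)))

SameEdge : {A : Set} → A → A → A → A → Set
SameEdge x y x' y' = (x ≡ x' × y ≡ y') ⊎ (x ≡ y' × y ≡ x')

record Drawing (G : Graph) : Set where
  field
    pos      : V G → Point
    pos-inj  : ∀ x y → pos x ≡ pos y → x ≡ y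
    arc      : V G → V G → Polyline
    arc-ok   : ∀ x y → E G x y → IsArc (arc x y)
    arc-ends : ∀ x y → E G x y → (start (arc x y) ≡ pos x) × (end (arc x y) ≡ pos y)
    arc-vtx  : ∀ x y z → E G x y → OnArc (arc x y) (pos z) → (z ≡ x) ⊎ (z ≡ y)
    arc-disj : ∀ x y x' y' q → E G x y → E G x' y' → ¬ SameEdge x y x' y' →
               OnArc (arc x y) q → OnArc (arc x' y') q → ∃ λ z → q ≡ pos z

Planar : Graph → Set
Planar G = Drawing G

{-# OPTIONS --safe #-}
module Submission where

-- Deleting u undoes the contraction of an edge uv: sending v to the contracted vertex
-- and every other vertex to itself embeds G − u into G/uv, and this embedding has a
-- retraction, so G − u − S embeds into G/uv − S' whenever S is the image of S' under
-- the retraction. Hence each contraction costs one deleted vertex, and a drawing of a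
-- graph restricts to a drawing of every graph embedded in it.

open import Defs
open import Data.Nat using (ℕ; suc; _≤_; s≤s; z≤n)
open import Data.List using (List; []; _∷_; [_]; length; map)
open import Data.List.Properties using (length-map)
open import Data.List.Membership.Propositional using (_∈_; _∉_)
open import Data.List.Membership.Propositional.Properties using (∈-map⁺)
open import Data.List.Relation.Unary.Any using (here; there)
open import Data.Product using (Σ; _×_; _,_; proj₁)
open import Data.Sum using (_⊎_; inj₁; inj₂)
open import Data.Unit using (tt)
open import Data.Bool using (T; not)
open import Data.Bool.Properties using (T-irrelevant)
open import Function.Definitions using (Injective)
open import Relation.Nullary using (¬_; yes; no)
open import Relation.Nullary.Decidable using (toWitnessFalse; fromWitnessFalse)
open import Relation.Binary.Definitions using (DecidableEquality)
open import Relation.Binary.PropositionalEquality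
  using (_≡_; _≢_; refl; sym; trans; cong; subst)

record _↪_ (A B : Graph) : Set where
  field
    to          : V A → V B
    injective   : Injective _≡_ _≡_ to
    preserves-E : ∀ {x y} → E A x y → E B (to x) (to y)
open _↪_

↪-trans : ∀ {A B C} → A ↪ B → B ↪ C → A ↪ C
↪-trans f g = record
  { to          = λ x → to g (to f x)
  ; injective   = λ eq → injective f (injective g eq)
  ; preserves-E = λ e → preserves-E g (preserves-E f e) }

planar-↪ : ∀ {A B} → A ↪ B → Planar B → Planar A
planar-↪ {A} {B} f D = record
  { pos      = λ x → pos (to f x)
  ; pos-inj  = λ x y eq → injective f (pos-inj (to f x) (to f y) eq)
  ; arc      = λ x y → arc (to f x) (to f y)
  ; arc-ok   = λ x y e → arc-ok (to f x) (to f y) (preserves-E f e)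
  ; arc-ends = λ x y e → arc-ends (to f x) (to f y) (preserves-E f e)
  ; arc-vtx  = vtx
  ; arc-disj = disj }
  where
  open Drawing D

  vtx : ∀ x y z → E A x y → OnArc (arc (to f x) (to f y)) (pos (to f z)) → (z ≡ x) ⊎ (z ≡ y)
  vtx x y z e on with arc-vtx (to f x) (to f y) (to f z) (preserves-E f e) on
  ... | inj₁ eq = inj₁ (injective f eq)
  ... | inj₂ eq = inj₂ (injective f eq)

  reflect-SameEdge : ∀ {x y x' y'} → ¬ SameEdge x y x' y' →
                     ¬ SameEdge (to f x) (to f y) (to f x') (to f y')
  reflect-SameEdge ns (inj₁ (p , q)) = ns (inj₁ (injective f p , injective f q))
  reflect-SameEdge ns (inj₂ (p , q)) = ns (inj₂ (injective f p , injective f q))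

  -- A crossing point of two image arcs is the position of some vertex of B, which lies
  -- on the arc of xy and hence is the image of x or y.
  disj : ∀ x y x' y' q → E A x y → E A x' y' → ¬ SameEdge x y x' y' →
         OnArc (arc (to f x) (to f y)) q → OnArc (arc (to f x') (to f y')) q →
         Σ (V A) λ z → q ≡ pos (to f z)
  disj x y x' y' q e e' ns on on'
    with arc-disj _ _ _ _ q (preserves-E f e) (preserves-E f e') (reflect-SameEdge ns) on on'
  ... | z , refl with arc-vtx (to f x) (to f y) z (preserves-E f e) on
  ... | inj₁ refl = x , refl
  ... | inj₂ refl = y , refl

module _ {A : Set} (_≟_ : DecidableEquality A) where

  memᵇ⇒∉ : ∀ {x} S → T (not (memᵇ _≟_ x S)) → x ∉ S
  memᵇ⇒∉ {x} (y ∷ S) p x∈ with x ≟ y | x∈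
  ... | no x≢y | here x≡y   = x≢y x≡y
  ... | no _   | there x∈S  = memᵇ⇒∉ S p x∈S

  ∉⇒memᵇ : ∀ {x} S → x ∉ S → T (not (memᵇ _≟_ x S))
  ∉⇒memᵇ []           x∉ = tt
  ∉⇒memᵇ {x} (y ∷ S) x∉ with x ≟ y
  ... | yes x≡y = x∉ (here x≡y)
  ... | no _    = ∉⇒memᵇ S (λ x∈S → x∉ (there x∈S))

proj₁-injective : ∀ {A : Set} {P : A → Set} → (∀ {a} → (p q : P a) → p ≡ q) →
                  Injective _≡_ _≡_ (proj₁ {B = P})
proj₁-injective irr {a , p} {.a , q} refl with irr p q
... | refl = refl

module _ (G : Graph) (S : List (V G)) where

  ─-∉ : (x : V (G ─ S)) → proj₁ x ∉ S
  ─-∉ (x , p) = memᵇ⇒∉ (_≟_ G) S p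

  ─-vertex : (x : V G) → x ∉ S → V (G ─ S)
  ─-vertex x x∉ = x , ∉⇒memᵇ (_≟_ G) S x∉

  ─-proj₁-injective : Injective _≡_ _≡_ (proj₁ {B = λ x → T (not (memᵇ (_≟_ G) x S))})
  ─-proj₁-injective = proj₁-injective T-irrelevant

─-↪ : (G : Graph) (S : List (V G)) → (G ─ S) ↪ G
─-↪ G S = record { to = proj₁ ; injective = ─-proj₁-injective G S ; preserves-E = λ e → e }

─-∷-↪ : (G : Graph) (u : V G) (S : List (V (G ─ [ u ]))) →
        (G ─ (u ∷ map proj₁ S)) ↪ ((G ─ [ u ]) ─ S)
─-∷-↪ G u S = record
  { to          = λ x → ─-vertex (G ─ [ u ]) S (─-vertex G [ u ] (proj₁ x) (∉-head x)) (∉-tail x)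
  ; injective   = λ eq → ─-proj₁-injective G S⁺ (cong (λ x → proj₁ (proj₁ x)) eq)
  ; preserves-E = λ e → e }
  where
  S⁺ : List (V G)
  S⁺ = u ∷ map proj₁ S

  ∉-head : (x : V (G ─ S⁺)) → proj₁ x ∉ [ u ]
  ∉-head x (here eq) = ─-∉ G S⁺ x (here eq)

  ∉-tail : (x : V (G ─ S⁺)) → ─-vertex G [ u ] (proj₁ x) (∉-head x) ∉ S
  ∉-tail x x∈S = ─-∉ G S⁺ x (there (∈-map⁺ proj₁ x∈S))

─-↪-retraction : ∀ {A B} (f : A ↪ B) (g : V B → V A) → (∀ x → g (to f x) ≡ x) →
                 (S : List (V B)) → (A ─ map g S) ↪ (B ─ S)
─-↪-retraction {A} {B} f g g∘f≗id S = record
  { to          = λ x → ─-vertex B S (to f (proj₁ x)) (∉-image x)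
  ; injective   = λ eq → ─-proj₁-injective A (map g S) (injective f (cong proj₁ eq))
  ; preserves-E = preserves-E f }
  where
  ∉-image : (x : V (A ─ map g S)) → to f (proj₁ x) ∉ S
  ∉-image x fx∈S = ─-∉ A (map g S) x (subst (_∈ map g S) (g∘f≗id (proj₁ x)) (∈-map⁺ g fx∈S))

module _ (G : Graph) {u v : V G} (u≢v : u ≢ v) where

  merge : V (G ─ [ u ]) → V (contract G u v)
  merge x with _≟_ G (proj₁ x) v
  ... | yes _   = inj₂ tt
  ... | no x≢v  = inj₁ (proj₁ x , fromWitnessFalse (λ eq → ─-∉ G [ u ] x (here eq)) ,
                                  fromWitnessFalse x≢v)

  unmerge : V (contract G u v) → V (G ─ [ u ])
  unmerge (inj₁ (x , x≢u , _)) = ─-vertex G [ u ] x λ { (here eq) → toWitnessFalse x≢u eq }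
  unmerge (inj₂ _)             = ─-vertex G [ u ] v λ { (here eq) → u≢v (sym eq) }

  unmerge-merge : ∀ x → unmerge (merge x) ≡ x
  unmerge-merge x with _≟_ G (proj₁ x) v
  ... | yes refl = ─-proj₁-injective G [ u ] refl
  ... | no _     = ─-proj₁-injective G [ u ] refl

  merge-preserves-E : ∀ {x y} → E G (proj₁ x) (proj₁ y) → E (contract G u v) (merge x) (merge y)
  merge-preserves-E {x} {y} e with _≟_ G (proj₁ x) v | _≟_ G (proj₁ y) v
  ... | yes refl | yes refl = E-irr G e
  ... | yes refl | no _     = inj₂ e
  ... | no _     | yes refl = inj₂ e
  ... | no _     | no _     = e

  ─-↪-contract : (G ─ [ u ]) ↪ contract G u v
  ─-↪-contract = record
    { to          = merge
    ; injective   = λ {x} {y} eq →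
        trans (sym (unmerge-merge x)) (trans (cong unmerge eq) (unmerge-merge y))
    ; preserves-E = merge-preserves-E }

planar-contraction⇒planar-deletion : ∀ {G k H} → G ⟶⟨ k ⟩ H → Planar H →
                        Σ (List (V G)) λ S → (length S ≤ k) × Planar (G ─ S)
planar-contraction⇒planar-deletion {G} done D = [] , z≤n , planar-↪ (─-↪ G []) D
planar-contraction⇒planar-deletion {G} {suc k} (step u v uv G/uv⟶H) D
  with planar-contraction⇒planar-deletion G/uv⟶H D
... | S , |S|≤k , D-S = u ∷ map proj₁ S⁻ , s≤s |S⁻|≤k , planar-↪ G-S⁺↪G/uv-S D-S
  where
  u≢v : u ≢ v
  u≢v refl = E-irr G uv

  S⁻ : List (V (G ─ [ u ]))
  S⁻ = map (unmerge G u≢v) S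

  |S⁻|≤k : length (map proj₁ S⁻) ≤ k
  |S⁻|≤k = subst (_≤ k) (sym (trans (length-map proj₁ S⁻) (length-map (unmerge G u≢v) S))) |S|≤k

  G-S⁺↪G/uv-S : (G ─ (u ∷ map proj₁ S⁻)) ↪ (contract G u v ─ S)
  G-S⁺↪G/uv-S = ↪-trans (─-∷-↪ G u S⁻)
    (─-↪-retraction (─-↪-contract G u≢v) (unmerge G u≢v) (unmerge-merge G u≢v) S)

lemma1 : (G : Graph) → Finite G → (k : ℕ) (H : Graph) →
    G ⟶⟨ k ⟩ H → Planar H →
    Σ (List (V G)) (λ S → (length S ≤ k) × Planar (G ─ S))
lemma1 G _ k H = planar-contraction⇒planar-deletion
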